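{- Let $\alpha_0,\beta_0,\alpha_1,\beta_1,\ldots$ be the formal power series in $z$ defined below. Then for all $k\ge0$, $\alpha_k=z^{2k+1}\widehat{\alpha}_k(z)$ and $\beta_k=z^{2k+2}\widehat{\beta}_k(z)$, where $\widehat{\alpha}_k$ and $\widehat{\beta}_k$ are formal power series in $z$ with $\widehat{\alpha}_k(0)=\widehat{\beta}_k(0)=1$.
   Context: Work in the ring of formal power series in $z$; for a formal power series $u$ with zero constant term, $\sqrt{1-u}$ denotes the formal power series square root with constant term $1$. Define $\alpha_0=\frac{1-\sqrt{1-8z^2}}{4z}$, $\beta_0=\frac{\alpha_0^2}{1+\alpha_0^2}$, and for a formal power series $t$ with zero constant term, $f(t)=\frac{1-\sqrt{1-4z^{2}(1+t^2)}}{2z(1+t^2)}\,t$. Define recursively $\alpha_{k+1}=f(\beta_k)$ for $k\ge0$ and $\beta_k=f(\alpha_k)$ for $k\ge1$. -}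

module Defs where

open import Data.Nat using (ℕ; zero; suc; _∸_; _≡ᵇ_)
open import Data.Bool using (if_then_else_)
open import Data.Integer using (+_)
open import Data.Rational using (ℚ; 0ℚ; 1ℚ; ½; _/_) renaming (_+_ to _+ℚ_; _*_ to _*ℚ_; _-_ to _-ℚ_; -_ to -ℚ_)

-- Formal power series in z over ℚ: n ↦ coefficient of z^n.
Series : Set
Series = ℕ → ℚ

sumTo : ℕ → (ℕ → ℚ) → ℚ
sumTo zero    g = 0ℚ
sumTo (suc n) g = sumTo n g +ℚ g n

const : ℚ → Series
const c zero    = c
const c (suc _) = 0ℚ

one : Series
one = const 1ℚ

zpow : ℕ → Series
zpow m n = if n ≡ᵇ m then 1ℚ else 0ℚ

_⊕_ : Series → Series → Series
(s ⊕ t) n = s n +ℚ t n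

_⊖_ : Series → Series → Series
(s ⊖ t) n = s n -ℚ t n

scale : ℚ → Series → Series
scale c s n = c *ℚ s n

_⊛_ : Series → Series → Series
(s ⊛ t) n = sumTo (suc n) (λ i → s i *ℚ t (n ∸ i))

-- division by z (used only for series with zero constant term)
divZ : Series → Series
divZ s n = s (suc n)

upd : Series → ℕ → ℚ → Series
upd g n v m = if m ≡ᵇ n then v else g m

-- Multiplicative inverse of a series with constant term 1:
-- b 0 = 1, b (n+1) = - Σ_{i=1}^{n+1} s_i b_{n+1-i}.
invStep : Series → Series → ℕ → ℚ
invStep s b zero    = 1ℚ
invStep s b (suc n) = -ℚ sumTo (suc n) (λ j → s (suc j) *ℚ b (n ∸ j))

invPre : Series → ℕ → Series
invPre s zero    = λ _ → 0ℚ
invPre s (suc n) = upd (invPre s n) n (invStep s (invPre s n) n)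

inv1 : Series → Series
inv1 s n = invPre s (suc n) n

-- Square root with constant term 1 of a series a with constant term 1:
-- r 0 = 1, r n = (a n - Σ_{i=1}^{n-1} r_i r_{n-i}) / 2 for n ≥ 1 (so r ⊛ r = a).
sqrtStep : Series → Series → ℕ → ℚ
sqrtStep a r zero    = 1ℚ
sqrtStep a r (suc m) = ½ *ℚ (a (suc m) -ℚ sumTo m (λ j → r (suc j) *ℚ r (m ∸ j)))

sqrtPre : Series → ℕ → Series
sqrtPre a zero    = λ _ → 0ℚ
sqrtPre a (suc n) = upd (sqrtPre a n) n (sqrtStep a (sqrtPre a n) n)

sqrt1 : Series → Series
sqrt1 a n = sqrtPre a (suc n) n

sqrt1m : Series → Series
sqrt1m u = sqrt1 (one ⊖ u)

sq : Series → Series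
sq s = s ⊛ s

-- α₀ = (1 - √(1 - 8z²)) / (4z)
alpha0 : Series
alpha0 = scale (+ 1 / 4) (divZ (one ⊖ sqrt1m (scale (+ 8 / 1) (zpow 2))))

beta0 : Series
beta0 = sq alpha0 ⊛ inv1 (one ⊕ sq alpha0)

-- f(t) = (1 - √(1 - 4z²(1+t²))) / (2z(1+t²)) · t
f : Series → Series
f t = scale ½ (divZ ((one ⊖ sqrt1m (scale (+ 4 / 1) (zpow 2 ⊛ (one ⊕ sq t)))) ⊛ inv1 (one ⊕ sq t))) ⊛ t

mutual
  alpha : ℕ → Series
  alpha zero    = alpha0
  alpha (suc k) = f (beta k)

  beta : ℕ → Series
  beta zero    = beta0
  beta (suc k) = f (alpha (suc k))

module Submission where

-- Say that a series s has order m with leading coefficient c,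
-- written  Order s m c,  when s = c·z^m + O(z^{m+1}).  The theorem is the claim
-- that α_k has order 2k+1 and β_k has order 2k+2, both with leading
-- coefficient 1: the factorisations s = z^m · ŝ then follow by taking ŝ to be
-- s shifted down by m (lemma factor-out).
--
-- The only analytic
-- input is the first two coefficients of a square root: if u has order 2 with
-- leading coefficient d, then 1 - √(1 - c·u) has order 2 with leading
-- coefficient c·d/2.  With these, f raises the order of any t with t(0) = 0 by
-- one and keeps its leading coefficient (lemma f-order), α₀ = z + O(z²) and β₀ = α₀²/(1+α₀²) = z² + O(z³); an
-- induction on k, alternating between α and β, gives the claim.

open import Defs
open import Data.Nat using (ℕ; zero; suc; _+_; _*_; _∸_; _<_; _≤_; _≡ᵇ_; z≤n; s≤s; _<?_)
open import Data.Nat.Properties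
  using (≤-refl; ≤-pred; m<n⇒m<1+n; <-irrefl; ≤∧≢⇒<; ≮⇒≥; m≤m+n; m+n∸m≡n; m+[n∸m]≡n;
         ∸-monoˡ-<; ∸-monoʳ-<; ∸-monoʳ-≤; ≤-trans; <-≤-trans; ≤-reflexive; ≡ᵇ⇒≡; ≡⇒≡ᵇ; _≟_)
  renaming (+-identityʳ to +-identityʳ-ℕ)
open import Data.Nat.Tactic.RingSolver using (solve-∀)
open import Data.Product using (Σ; _×_; _,_; proj₁; proj₂)
open import Data.Bool using (true; false; T)
open import Data.Unit using (tt)
open import Data.Empty using (⊥-elim)
open import Data.Integer using (+_)
open import Data.Rational using (ℚ; 0ℚ; 1ℚ; ½; _/_) renaming (_+_ to _+ℚ_; _*_ to _*ℚ_; _-_ to _-ℚ_)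
open import Data.Rational.Properties using (+-identityˡ; +-identityʳ; *-zeroˡ; *-zeroʳ; *-identityˡ)
open import Data.Rational.Solver using (module +-*-Solver)
open import Relation.Nullary using (yes; no; ¬_)
open import Relation.Binary.PropositionalEquality using (_≡_; refl; sym; trans; cong; cong₂; subst)

Order : Series → ℕ → ℚ → Set
Order s m c = ((n : ℕ) → n < m → s n ≡ 0ℚ) × s m ≡ c

Order-lead : ∀ {s m c c′} → c ≡ c′ → Order s m c → Order s m c′
Order-lead c≡c′ (below , lead) = below , trans lead c≡c′

sumTo-vanishes : (N : ℕ) (h : ℕ → ℚ) → ((i : ℕ) → i < N → h i ≡ 0ℚ) → sumTo N h ≡ 0ℚ
sumTo-vanishes zero    h zeros = refl
sumTo-vanishes (suc N) h zeros =
  cong₂ _+ℚ_ (sumTo-vanishes N h (λ i i<N → zeros i (m<n⇒m<1+n i<N))) (zeros N ≤-refl)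

sumTo-single : (N p : ℕ) (h : ℕ → ℚ) → p < N →
               ((i : ℕ) → i < N → ¬ i ≡ p → h i ≡ 0ℚ) → sumTo N h ≡ h p
sumTo-single (suc N) p h p<1+N zeros with N ≟ p
... | yes refl =
  trans (cong (_+ℚ h N) (sumTo-vanishes N h (λ i i<N → zeros i (m<n⇒m<1+n i<N) (λ i≡N → <-irrefl i≡N i<N))))
        (+-identityˡ (h N))
... | no N≢p =
  trans (cong₂ _+ℚ_ (sumTo-single N p h (≤∧≢⇒< (≤-pred p<1+N) (λ p≡N → N≢p (sym p≡N)))
                                  (λ i i<N → zeros i (m<n⇒m<1+n i<N)))
                    (zeros N ≤-refl N≢p))
        (+-identityʳ (h p))

zpow-off : ∀ m i → ¬ i ≡ m → zpow m i ≡ 0ℚ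
zpow-off m i i≢m with i ≡ᵇ m in eq
... | true  = ⊥-elim (i≢m (≡ᵇ⇒≡ i m (subst T (sym eq) tt)))
... | false = refl

zpow-off-times : ∀ m i x → ¬ i ≡ m → zpow m i *ℚ x ≡ 0ℚ
zpow-off-times m i x i≢m = trans (cong (_*ℚ x) (zpow-off m i i≢m)) (*-zeroˡ x)

zpow-on : ∀ m → zpow m m ≡ 1ℚ
zpow-on m with m ≡ᵇ m in eq
... | true  = refl
... | false = ⊥-elim (subst T eq (≡⇒≡ᵇ m m refl))

zpow-order : ∀ m → Order (zpow m) m 1ℚ
zpow-order m = (λ n n<m → zpow-off m n (λ n≡m → <-irrefl n≡m n<m)) , zpow-on m

scale-order : ∀ {s m c} d → Order s m c → Order (scale d s) m (d *ℚ c)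
scale-order d (below , lead) =
  (λ n n<m → trans (cong (d *ℚ_) (below n n<m)) (*-zeroʳ d)) , cong (d *ℚ_) lead

divZ-order : ∀ {s m c} → Order s (suc m) c → Order (divZ s) m c
divZ-order (below , lead) = (λ n n<m → below (suc n) (s≤s n<m)) , lead

-- The formal inverse always starts with 1 (it is 1/s whenever s(0) = 1).
inv1-order : ∀ s → Order (inv1 s) 0 1ℚ
inv1-order s = (λ n ()) , refl

one⊕-order : ∀ {s} → s 0 ≡ 0ℚ → Order (one ⊕ s) 0 1ℚ
one⊕-order s₀ = (λ n ()) , cong (1ℚ +ℚ_) s₀

product-order : ∀ {s t a b c d} → Order s a c → Order t b d → Order (s ⊛ t) (a + b) (c *ℚ d)
product-order {s} {t} {a} {b} {c} {d} (s-below , s-lead) (t-below , t-lead) = below , lead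
  where
  term-zero : ∀ n i → (a ≤ i → n ∸ i < b) → s i *ℚ t (n ∸ i) ≡ 0ℚ
  term-zero n i high with i <? a
  ... | yes i<a = trans (cong (_*ℚ t (n ∸ i)) (s-below i i<a)) (*-zeroˡ (t (n ∸ i)))
  ... | no  i≮a = trans (cong (s i *ℚ_) (t-below (n ∸ i) (high (≮⇒≥ i≮a)))) (*-zeroʳ (s i))

  small-rest : ∀ {i n} → a ≤ i → i ≤ n → n < a + b → n ∸ i < b
  small-rest {i} {n} a≤i i≤n n<a+b =
    <-≤-trans (∸-monoˡ-< n<a+b i≤n)
              (≤-trans (∸-monoʳ-≤ (a + b) a≤i) (≤-reflexive (m+n∸m≡n a b)))

  lead-rest : ∀ {i} → a < i → i ≤ a + b → (a + b) ∸ i < b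
  lead-rest a<i i≤a+b = <-≤-trans (∸-monoʳ-< a<i i≤a+b) (≤-reflexive (m+n∸m≡n a b))

  below : (n : ℕ) → n < a + b → (s ⊛ t) n ≡ 0ℚ
  below n n<a+b = sumTo-vanishes (suc n) _
    (λ i i<1+n → term-zero n i (λ a≤i → small-rest a≤i (≤-pred i<1+n) n<a+b))

  lead : (s ⊛ t) (a + b) ≡ c *ℚ d
  lead = trans (sumTo-single (suc (a + b)) a _ (s≤s (m≤m+n a b))
                 (λ i i<1+n i≢a → term-zero (a + b) i (λ a≤i →
                    lead-rest (≤∧≢⇒< a≤i (λ a≡i → i≢a (sym a≡i))) (≤-pred i<1+n))))
               (trans (cong (λ j → s a *ℚ t j) (m+n∸m≡n a b)) (cong₂ _*ℚ_ s-lead t-lead))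

sqrt1-low : ∀ a → a 1 ≡ 0ℚ → sqrt1 a 1 ≡ 0ℚ × sqrt1 a 2 ≡ ½ *ℚ a 2
sqrt1-low a a₁ rewrite a₁ = refl , cong (½ *ℚ_) (+-identityʳ (a 2))

one-minus-sqrt-order : ∀ c {u d} → Order u 2 d → Order (one ⊖ sqrt1m (scale c u)) 2 (½ *ℚ (c *ℚ d))
one-minus-sqrt-order c {u} {d} (u-below , u-lead) = below , lead
  where
  open +-*-Solver
  radicand₁ : (one ⊖ scale c u) 1 ≡ 0ℚ
  radicand₁ = trans (cong (λ x → 0ℚ -ℚ c *ℚ x) (u-below 1 (s≤s (s≤s z≤n)))) (cong (0ℚ -ℚ_) (*-zeroʳ c))
  roots : sqrt1m (scale c u) 1 ≡ 0ℚ × sqrt1m (scale c u) 2 ≡ ½ *ℚ (0ℚ -ℚ c *ℚ u 2)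
  roots = sqrt1-low (one ⊖ scale c u) radicand₁

  halve-negate : ∀ h x → 0ℚ -ℚ h *ℚ (0ℚ -ℚ x) ≡ h *ℚ x
  halve-negate = solve 2 (λ h x → con 0ℚ :- h :* (con 0ℚ :- x) := h :* x) refl

  below : (n : ℕ) → n < 2 → (one ⊖ sqrt1m (scale c u)) n ≡ 0ℚ
  below zero          _ = refl
  below (suc zero)    _ = cong (0ℚ -ℚ_) (proj₁ roots)
  below (suc (suc n)) (s≤s (s≤s ()))

  lead : (one ⊖ sqrt1m (scale c u)) 2 ≡ ½ *ℚ (c *ℚ d)
  lead = trans (cong (0ℚ -ℚ_) (proj₂ roots))
               (trans (halve-negate ½ (c *ℚ u 2)) (cong (λ x → ½ *ℚ (c *ℚ x)) u-lead))

-- The recursion step: if t = c·z^{m+1} + …, then f(t) = c·z^{m+2} + …,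
-- since f(t) = (z + O(z²))·t.
f-order : ∀ {t m c} → Order t (suc m) c → Order (f t) (suc (suc m)) c
f-order {t} {c = c} t-order =
  Order-lead (*-identityˡ c) (product-order (scale-order ½ (divZ-order quotient)) t-order)
  where
  denominator : Order (one ⊕ sq t) 0 1ℚ
  denominator = one⊕-order (proj₁ (product-order t-order t-order) 0 (s≤s z≤n))
  quotient : Order ((one ⊖ sqrt1m (scale (+ 4 / 1) (zpow 2 ⊛ (one ⊕ sq t)))) ⊛ inv1 (one ⊕ sq t)) 2 (+ 2 / 1)
  quotient = product-order (one-minus-sqrt-order (+ 4 / 1) (product-order (zpow-order 2) denominator))
                           (inv1-order (one ⊕ sq t))

alpha0-order : Order alpha0 1 1ℚ
alpha0-order = scale-order (+ 1 / 4) (divZ-order (one-minus-sqrt-order (+ 8 / 1) (zpow-order 2)))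

beta0-order : Order beta0 2 1ℚ
beta0-order = product-order (product-order alpha0-order alpha0-order) (inv1-order (one ⊕ sq alpha0))

orders : ∀ k → Order (alpha k) (2 * k + 1) 1ℚ × Order (beta k) (2 * k + 2) 1ℚ
orders zero    = alpha0-order , beta0-order
orders (suc k) = reindex (index-α k) alpha-order , reindex (index-β k) (f-order alpha-order)
  where
  reindex : ∀ {s m m′} → m ≡ m′ → Order s m 1ℚ → Order s m′ 1ℚ
  reindex refl o = o
  index-β₀ : ∀ j → 2 * j + 2 ≡ suc (2 * j + 1)
  index-β₀ = solve-∀
  index-α : ∀ j → suc (suc (2 * j + 1)) ≡ 2 * suc j + 1
  index-α = solve-∀
  index-β : ∀ j → suc (suc (suc (2 * j + 1))) ≡ 2 * suc j + 2
  index-β = solve-∀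
  alpha-order : Order (alpha (suc k)) (suc (suc (2 * k + 1))) 1ℚ
  alpha-order = f-order (reindex (index-β₀ k) (proj₂ (orders k)))

shift : ℕ → Series → Series
shift m s j = s (m + j)

factor-out : ∀ {s m} → ((n : ℕ) → n < m → s n ≡ 0ℚ) → (n : ℕ) → s n ≡ (zpow m ⊛ shift m s) n
factor-out {s} {m} below n with n <? m
... | yes n<m = trans (below n n<m) (sym (sumTo-vanishes (suc n) _ (λ i i<1+n →
        zpow-off-times m i _ (λ i≡m → <-irrefl i≡m (<-≤-trans i<1+n n<m)))))
... | no  n≮m = sym (trans (sumTo-single (suc n) m _ (s≤s m≤n) (λ i _ → zpow-off-times m i _))
                           (trans (cong (_*ℚ s (m + (n ∸ m))) (zpow-on m))
                                  (trans (*-identityˡ _) (cong s (m+[n∸m]≡n m≤n)))))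
  where
  m≤n : m ≤ n
  m≤n = ≮⇒≥ n≮m

shift-const : ∀ {s m c} → Order s m c → shift m s 0 ≡ c
shift-const {s} {m} (_ , lead) = trans (cong s (+-identityʳ-ℕ m)) lead

proposition3 : (k : ℕ) →
    Σ Series (λ ah → Σ Series (λ bh →
    ((n : ℕ) → alpha k n ≡ (zpow (2 * k + 1) ⊛ ah) n) × ah 0 ≡ 1ℚ ×
    ((n : ℕ) → beta k n ≡ (zpow (2 * k + 2) ⊛ bh) n) × bh 0 ≡ 1ℚ))
proposition3 k =
  shift (2 * k + 1) (alpha k) , shift (2 * k + 2) (beta k) ,
  factor-out (proj₁ α-order) , shift-const α-order ,
  factor-out (proj₁ β-order) , shift-const β-order
  where
  α-order : Order (alpha k) (2 * k + 1) 1ℚ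
  α-order = proj₁ (orders k)
  β-order : Order (beta k) (2 * k + 2) 1ℚ
  β-order = proj₂ (orders k)
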